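{- Let $n,k$ be positive integers. For every ordered partition $\pi\in\mathcal{OP}_n^k$, $$\mathrm{mak}(\pi)+\mathrm{bmaj}(\pi)=\mathrm{lmak}'(\pi)+\mathrm{bmaj}(\pi),\qquad \mathrm{mak}'(\pi)+\mathrm{bmaj}(\pi)=\mathrm{lmak}(\pi)+\mathrm{bmaj}(\pi),$$ $$\mathrm{mak}(\pi)+\mathrm{binv}(\pi)=\mathrm{lmak}'(\pi)+\mathrm{binv}(\pi),\qquad \mathrm{mak}'(\pi)+\mathrm{binv}(\pi)=\mathrm{lmak}(\pi)+\mathrm{binv}(\pi).$$
   Context: A $k$-ordered partition of $[n]$ is a sequence $\pi=(B_1,\dots,B_k)$, also written $B_1-\cdots-B_k$, of nonempty pairwise disjoint subsets of $[n]$ whose union is $[n]$. The blocks are in an arbitrary order. $\mathcal{OP}_n^k$ denotes the set of these. Let $w_i$ be the index $j$ of the block $B_j$ containing $i$ (positions in the given order). The openers $\mathcal O(\pi)$ are the smallest elements of the blocks, and the closers $\mathcal F(\pi)$ are their largest elements. For $i\in[n]$ define: $\mathrm{ros}_i=\#\{j\in\mathcal O: j<i,\ w_j>w_i\}$, $\mathrm{rob}_i=\#\{j\in\mathcal O: j>i,\ w_j>w_i\}$, $\mathrm{rcs}_i=\#\{j\in\mathcal F: j<i,\ w_j>w_i\}$, $\mathrm{rcb}_i=\#\{j\in\mathcal F: j>i,\ w_j>w_i\}$, $\mathrm{los}_i=\#\{j\in\mathcal O: j<i,\ w_j<w_i\}$, $\mathrm{lob}_i=\#\{j\in\mathcal O: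 j>i,\ w_j<w_i\}$, $\mathrm{lcs}_i=\#\{j\in\mathcal F: j<i,\ w_j<w_i\}$, $\mathrm{lcb}_i=\#\{j\in\mathcal F: j>i,\ w_j<w_i\}$. Each statistic is the sum of its coordinates. Set $\mathrm{mak}=\mathrm{ros}+\mathrm{lcs}$, $\mathrm{mak}'=\mathrm{lob}+\mathrm{rcb}$, $\mathrm{lmak}'=n(k-1)-(\mathrm{lcb}+\mathrm{rob})$ and $\mathrm{lmak}=n(k-1)-(\mathrm{los}+\mathrm{rcs})$. Write $B_i>B_j$ if every element of $B_i$ is larger than every element of $B_j$. An index $i\in[k-1]$ is a descent if $B_i>B_{i+1}$. $\mathrm{bmaj}(\pi)$ is the sum of the descents of $\pi$. $\mathrm{binv}(\pi)$ is the number of pairs $(i,j)$ with $i<j$ and $B_i>B_j$. -}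

module Defs where

open import Data.Nat using (ℕ; zero; suc; _+_; _*_; _∸_; _<ᵇ_; _≡ᵇ_)
open import Data.Integer using (ℤ; +_; _-_)
open import Data.Bool using (Bool; true; false; _∧_; _∨_; not; if_then_else_)
open import Data.Fin using (Fin; toℕ)
open import Data.List using (List; allFin; map)
open import Data.Nat.ListAction using (sum)
open import Data.Bool.ListAction using (any; all)
open import Data.Product using (∃)
open import Relation.Binary.PropositionalEquality using (_≡_)

-- Elements of [n] are encoded as Fin n (element i+1 ↦ i, order preserved);
-- block positions 1..k are encoded as Fin k (position j+1 ↦ j).
-- An ordered partition B_1 - ... - B_k of [n] is given by its word
-- w : [n] → [k] (w_i = index of the block containing i); blocks are
-- B_j = w⁻¹(j), and nonemptiness of every block is surjectivity of w.
record OrderedPartition (n k : ℕ) : Set where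
  field
    w    : Fin n → Fin k
    surj : (j : Fin k) → ∃ λ i → w i ≡ j
open OrderedPartition public

Σ[_]_ : (n : ℕ) → (Fin n → ℕ) → ℕ
Σ[ n ] f = sum (map f (allFin n))

#[_]_ : (n : ℕ) → (Fin n → Bool) → ℕ
#[ n ] p = Σ[ n ] (λ j → if p j then 1 else 0)

_<F_ : ∀ {m} → Fin m → Fin m → Bool
a <F b = toℕ a <ᵇ toℕ b

_==F_ : ∀ {m} → Fin m → Fin m → Bool
a ==F b = toℕ a ≡ᵇ toℕ b

module _ {n k : ℕ} (π : OrderedPartition n k) where

  isOpener : Fin n → Bool
  isOpener i = not (any (λ j → (j <F i) ∧ (w π j ==F w π i)) (allFin n))

  isCloser : Fin n → Bool
  isCloser i = not (any (λ j → (i <F j) ∧ (w π j ==F w π i)) (allFin n))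

  ros-i rob-i rcs-i rcb-i los-i lob-i lcs-i lcb-i : Fin n → ℕ
  ros-i i = #[ n ] (λ j → isOpener j ∧ (j <F i) ∧ (w π i <F w π j))
  rob-i i = #[ n ] (λ j → isOpener j ∧ (i <F j) ∧ (w π i <F w π j))
  rcs-i i = #[ n ] (λ j → isCloser j ∧ (j <F i) ∧ (w π i <F w π j))
  rcb-i i = #[ n ] (λ j → isCloser j ∧ (i <F j) ∧ (w π i <F w π j))
  los-i i = #[ n ] (λ j → isOpener j ∧ (j <F i) ∧ (w π j <F w π i))
  lob-i i = #[ n ] (λ j → isOpener j ∧ (i <F j) ∧ (w π j <F w π i))
  lcs-i i = #[ n ] (λ j → isCloser j ∧ (j <F i) ∧ (w π j <F w π i))
  lcb-i i = #[ n ] (λ j → isCloser j ∧ (i <F j) ∧ (w π j <F w π i))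

  ros rob rcs rcb los lob lcs lcb : ℕ
  ros = Σ[ n ] ros-i
  rob = Σ[ n ] rob-i
  rcs = Σ[ n ] rcs-i
  rcb = Σ[ n ] rcb-i
  los = Σ[ n ] los-i
  lob = Σ[ n ] lob-i
  lcs = Σ[ n ] lcs-i
  lcb = Σ[ n ] lcb-i

  mak mak′ : ℕ
  mak  = ros + lcs
  mak′ = lob + rcb

  -- computed in ℤ so that no truncated subtraction is involved
  lmak′ lmak : ℤ
  lmak′ = + (n * (k ∸ 1)) - + (lcb + rob)
  lmak  = + (n * (k ∸ 1)) - + (los + rcs)

  blockGreater : Fin k → Fin k → Bool
  blockGreater a b =
    all (λ x → all (λ y → not (w π x ==F a) ∨ not (w π y ==F b) ∨ (y <F x))
                   (allFin n))
        (allFin n)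

  -- bmaj: sum of descents i ∈ [k-1] (1-based), B_i > B_{i+1}.
  -- With 0-based positions p, q = p+1, the descent is i = p+1.
  bmaj : ℕ
  bmaj = Σ[ k ] (λ p → Σ[ k ] (λ q →
           if (toℕ q ≡ᵇ suc (toℕ p)) ∧ blockGreater p q then suc (toℕ p) else 0))

  binv : ℕ
  binv = Σ[ k ] (λ a → #[ k ] (λ b → (a <F b) ∧ blockGreater a b))

module Submission where

-- Every block has exactly one opener and exactly one closer.  For fixed i, an
-- opener j with w_j > w_i is distinct from i, so ros_i + rob_i counts the openers
-- of the blocks after B_{w_i}, namely k - w_i; in the same way
-- lcs_i + lcb_i = los_i + lob_i = w_i - 1 and rcs_i + rcb_i = k - w_i.  Summing
-- over i gives mak + lcb + rob = n(k - 1) = mak' + los + rcs, that is mak = lmak'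
-- and mak' = lmak.

open import Defs

-- A separate module, because the statement of proposition2 uses the _+_ of ℤ.
module Counting where

  open import Data.Bool.Base using (Bool; true; false; T; not; _∧_; if_then_else_)
  open import Data.Bool.Properties using (T?; T-∧)
  open import Data.Bool.ListAction using (any)
  open import Data.Empty using (⊥-elim)
  open import Data.Fin.Base using (Fin; zero; suc; toℕ)
  open import Data.Fin.Induction using (<-wellFounded; >-wellFounded)
  open import Data.Fin.Properties using (_≟_; <-cmp; toℕ-injective; toℕ≤pred[n])
  import Data.Integer.Base as ℤ
  open import Data.Integer.Properties using (m-n≡m⊖n; ⊖-≥)
  open import Data.List.Base using (tabulate; allFin)
  open import Data.List.Properties using (map-tabulate)
  open import Data.List.Relation.Unary.Any using (satisfied)
  open import Data.List.Relation.Unary.Any.Properties using (any⁺; any⁻; tabulate⁺)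
  open import Data.Nat.Base using (ℕ; zero; suc; _+_; _*_; _∸_; _<_; pred)
  open import Data.Nat.ListAction using (sum)
  open import Data.Nat.Properties
    using (+-0-commutativeMonoid; +-*-semiring; +-identityʳ; *-identityˡ; *-identityʳ;
           <ᵇ⇒<; <⇒<ᵇ; ≡ᵇ⇒≡; ≡⇒≡ᵇ; <-irrefl; <-asym; m+[n∸m]≡n; m+n∸n≡m; m≤n+m)
  open import Algebra.Properties.CommutativeMonoid.Sum +-0-commutativeMonoid
    using (sum-syntax; sum-cong-≗; ∑-distrib-+; ∑-comm; sum-replicate-zero)
  open import Algebra.Properties.Semiring.Sum +-*-semiring using (*-distribʳ-sum)
  open import Data.Nat.Tactic.RingSolver using (solve-∀)
  open import Data.Product using (∃; _×_; _,_)
  open import Data.Sum using (_⊎_; inj₁; inj₂; swap)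
  open import Data.Unit using (tt)
  open import Function using (_∘_; id; flip; Equivalence)
  open import Induction.WellFounded using (WellFounded; Acc; acc; module Subrelation)
  open import Relation.Binary.Definitions using (tri<; tri≈; tri>)
  open import Relation.Binary.PropositionalEquality
    using (_≡_; _≢_; refl; sym; trans; cong; cong₂; subst; ≢-sym; module ≡-Reasoning)
  open import Relation.Nullary using (¬_; yes; no)

  open ≡-Reasoning

  χ : Bool → ℕ
  χ b = if b then 1 else 0

  T-not⇒¬T : ∀ {x} → T (not x) → ¬ T x
  T-not⇒¬T {true} ()

  ¬T-not⇒T : ∀ {x} → ¬ T (not x) → T x
  ¬T-not⇒T {false} ¬t = ¬t tt
  ¬T-not⇒T {true}  _  = tt

  T-injective : ∀ {x y} → (T x → T y) → (T y → T x) → x ≡ y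
  T-injective {false} {false} _ _ = refl
  T-injective {false} {true}  _ g = ⊥-elim (g tt)
  T-injective {true}  {false} f _ = ⊥-elim (f tt)
  T-injective {true}  {true}  _ _ = refl

  χ-split : ∀ o x y q → (T q → T x ⊎ T y) → (T q → T x → ¬ T y) →
            χ (o ∧ x ∧ q) + χ (o ∧ y ∧ q) ≡ χ (o ∧ q)
  χ-split false _     _     _     _      _    = refl
  χ-split true  false false false _      _    = refl
  χ-split true  false false true  x⊎y    _    with x⊎y tt
  ... | inj₁ ()
  ... | inj₂ ()
  χ-split true  false true  _     _      _    = refl
  χ-split true  true  false q     _      _    = +-identityʳ (χ q)
  χ-split true  true  true  false _      _    = refl
  χ-split true  true  true  true  _      x⇒¬y = ⊥-elim (x⇒¬y tt tt tt)

  if-χ-∧ : ∀ e x p → (if e then χ (x ∧ p) else 0) ≡ χ (x ∧ e) * χ p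
  if-χ-∧ false false _     = refl
  if-χ-∧ false true  _     = refl
  if-χ-∧ true  false _     = refl
  if-χ-∧ true  true  false = refl
  if-χ-∧ true  true  true  = refl

  ==F⇒≡ : ∀ {m} {a b : Fin m} → T (a ==F b) → a ≡ b
  ==F⇒≡ t = toℕ-injective (≡ᵇ⇒≡ _ _ t)

  ≡⇒==F : ∀ {m} {a b : Fin m} → a ≡ b → T (a ==F b)
  ≡⇒==F a≡b = ≡⇒≡ᵇ _ _ (cong toℕ a≡b)

  <F⇒< : ∀ {m} {a b : Fin m} → T (a <F b) → toℕ a < toℕ b
  <F⇒< t = <ᵇ⇒< _ _ t

  <F-irrefl : ∀ {m} {a : Fin m} → ¬ T (a <F a)
  <F-irrefl {a = a} t = <-irrefl refl (<F⇒< {a = a} {a} t)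

  <F-asym : ∀ {m} {a b : Fin m} → T (a <F b) → ¬ T (b <F a)
  <F-asym {a = a} {b} t t′ = <-asym (<F⇒< {a = a} {b} t) (<F⇒< {a = b} {a} t′)

  <F-connex : ∀ {m} {a b : Fin m} → a ≢ b → T (a <F b) ⊎ T (b <F a)
  <F-connex {a = a} {b} a≢b with <-cmp a b
  ... | tri< a<b _ _ = inj₁ (<⇒<ᵇ a<b)
  ... | tri≈ _ a≡b _ = ⊥-elim (a≢b a≡b)
  ... | tri> _ _ b<a = inj₂ (<⇒<ᵇ b<a)

  Σ≡∑ : ∀ n (f : Fin n → ℕ) → Σ[ n ] f ≡ ∑[ i < n ] f i
  Σ≡∑ n f = trans (cong sum (map-tabulate id f)) (sum-tabulate f)
    where
    sum-tabulate : ∀ {m} (g : Fin m → ℕ) → sum (tabulate g) ≡ ∑[ i < m ] g i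
    sum-tabulate {zero}  g = refl
    sum-tabulate {suc m} g = cong (g zero +_) (sum-tabulate (g ∘ suc))

  Σ-+ : ∀ n (f g : Fin n → ℕ) → Σ[ n ] (λ i → f i + g i) ≡ Σ[ n ] f + Σ[ n ] g
  Σ-+ n f g = begin
    Σ[ n ] (λ i → f i + g i)        ≡⟨ Σ≡∑ n _ ⟩
    ∑[ i < n ] (f i + g i)          ≡⟨ ∑-distrib-+ f g ⟩
    ∑[ i < n ] f i + ∑[ i < n ] g i ≡⟨ cong₂ _+_ (Σ≡∑ n f) (Σ≡∑ n g) ⟨
    Σ[ n ] f + Σ[ n ] g             ∎

  ∑-const : ∀ n c → ∑[ i < n ] c ≡ n * c
  ∑-const zero    c = refl
  ∑-const (suc n) c = cong (c +_) (∑-const n c)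

  Σ-constant : ∀ n {f : Fin n → ℕ} {c} → (∀ i → f i ≡ c) → Σ[ n ] f ≡ n * c
  Σ-constant n {f} {c} f≡c = begin
    Σ[ n ] f       ≡⟨ Σ≡∑ n f ⟩
    ∑[ i < n ] f i ≡⟨ sum-cong-≗ f≡c ⟩
    ∑[ i < n ] c   ≡⟨ ∑-const n c ⟩
    n * c          ∎

  ∑-δ : ∀ {k} (c : Fin k) (g : Fin k → ℕ) → ∑[ b < k ] (if c ==F b then g b else 0) ≡ g c
  ∑-δ {suc k} zero    g =
    trans (cong (g zero +_) (sum-replicate-zero k)) (+-identityʳ (g zero))
  ∑-δ {suc k} (suc c) g = ∑-δ c (g ∘ suc)

  #-singleton : ∀ {n} (p : Fin n → Bool) {i : Fin n} → T (p i) → (∀ {j} → T (p j) → j ≡ i) →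
                #[ n ] p ≡ 1
  #-singleton {n} p {i} pi only-i = begin
    #[ n ] p               ≡⟨ Σ≡∑ n _ ⟩
    ∑[ j < n ] χ (p j)     ≡⟨ sum-cong-≗ (cong χ ∘ p≡i==F) ⟩
    ∑[ j < n ] χ (i ==F j) ≡⟨ ∑-δ i (λ _ → 1) ⟩
    1                      ∎
    where
    p≡i==F : ∀ j → p j ≡ (i ==F j)
    p≡i==F j = T-injective (≡⇒==F ∘ sym ∘ only-i) (λ t → subst (T ∘ p) (==F⇒≡ t) pi)

  #-below : ∀ {k} (c : Fin k) → #[ k ] (_<F c) ≡ toℕ c
  #-below {k} c = trans (Σ≡∑ k _) (∑-below c)
    where
    ∑-below : ∀ {m} (c : Fin m) → ∑[ b < m ] χ (b <F c) ≡ toℕ c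
    ∑-below {suc m} zero    = sum-replicate-zero m
    ∑-below {suc m} (suc c) = cong suc (∑-below c)

  #-above : ∀ {k} (c : Fin k) → #[ k ] (c <F_) ≡ pred k ∸ toℕ c
  #-above {k} c = trans (Σ≡∑ k _) (∑-above c)
    where
    ∑-above : ∀ {m} (c : Fin m) → ∑[ b < m ] χ (c <F b) ≡ pred m ∸ toℕ c
    ∑-above {suc m}       zero    = trans (∑-const m 1) (*-identityʳ m)
    ∑-above {suc (suc m)} (suc c) = ∑-above c

  #-below+#-above : ∀ {k} (c : Fin k) → #[ k ] (_<F c) + #[ k ] (c <F_) ≡ k ∸ 1
  #-below+#-above c = trans (cong₂ _+_ (#-below c) (#-above c)) (m+[n∸m]≡n (toℕ≤pred[n] c))

  #-split-at : ∀ {n} (o q : Fin n → Bool) (i : Fin n) → (∀ {j} → T (q j) → j ≢ i) →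
               #[ n ] (λ j → o j ∧ (j <F i) ∧ q j) + #[ n ] (λ j → o j ∧ (i <F j) ∧ q j)
                 ≡ #[ n ] (λ j → o j ∧ q j)
  #-split-at {n} o q i q⇒≢i = begin
    #[ n ] (λ j → o j ∧ (j <F i) ∧ q j) + #[ n ] (λ j → o j ∧ (i <F j) ∧ q j)
      ≡⟨ cong₂ _+_ (Σ≡∑ n _) (Σ≡∑ n _) ⟩
    ∑[ j < n ] χ (o j ∧ (j <F i) ∧ q j) + ∑[ j < n ] χ (o j ∧ (i <F j) ∧ q j)
      ≡⟨ ∑-distrib-+ (λ j → χ (o j ∧ (j <F i) ∧ q j)) (λ j → χ (o j ∧ (i <F j) ∧ q j)) ⟨
    ∑[ j < n ] (χ (o j ∧ (j <F i) ∧ q j) + χ (o j ∧ (i <F j) ∧ q j))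
      ≡⟨ sum-cong-≗ split ⟩
    ∑[ j < n ] χ (o j ∧ q j)
      ≡⟨ Σ≡∑ n _ ⟨
    #[ n ] (λ j → o j ∧ q j)
      ∎
    where
    split : ∀ j → χ (o j ∧ (j <F i) ∧ q j) + χ (o j ∧ (i <F j) ∧ q j) ≡ χ (o j ∧ q j)
    split j = χ-split (o j) (j <F i) (i <F j) (q j) (<F-connex ∘ q⇒≢i) (λ _ → <F-asym {a = j} {i})

  #-by-fibre : ∀ {n k} (f : Fin n → Fin k) (m : Fin n → Bool) →
               (∀ b → #[ n ] (λ j → m j ∧ (f j ==F b)) ≡ 1) →
               ∀ P → #[ n ] (λ j → m j ∧ P (f j)) ≡ #[ k ] P
  #-by-fibre {n} {k} f m one-per-fibre P = begin
    #[ n ] (λ j → m j ∧ P (f j))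
      ≡⟨ Σ≡∑ n _ ⟩
    ∑[ j < n ] χ (m j ∧ P (f j))
      ≡⟨ sum-cong-≗ (λ j → ∑-δ (f j) (λ b → χ (m j ∧ P b))) ⟨
    ∑[ j < n ] ∑[ b < k ] (if f j ==F b then χ (m j ∧ P b) else 0)
      ≡⟨ sum-cong-≗ (λ j → sum-cong-≗ (λ b → if-χ-∧ (f j ==F b) (m j) (P b))) ⟩
    ∑[ j < n ] ∑[ b < k ] (χ (m j ∧ (f j ==F b)) * χ (P b))
      ≡⟨ ∑-comm (λ j b → χ (m j ∧ (f j ==F b)) * χ (P b)) ⟩
    ∑[ b < k ] ∑[ j < n ] (χ (m j ∧ (f j ==F b)) * χ (P b))
      ≡⟨ sum-cong-≗ (λ b → *-distribʳ-sum (χ (P b)) (λ j → χ (m j ∧ (f j ==F b)))) ⟨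
    ∑[ b < k ] (∑[ j < n ] χ (m j ∧ (f j ==F b)) * χ (P b))
      ≡⟨ sum-cong-≗ (λ b → cong (_* χ (P b)) (trans (sym (Σ≡∑ n _)) (one-per-fibre b))) ⟩
    ∑[ b < k ] (1 * χ (P b))
      ≡⟨ sum-cong-≗ (λ b → *-identityˡ (χ (P b))) ⟩
    ∑[ b < k ] χ (P b)
      ≡⟨ Σ≡∑ k _ ⟨
    #[ k ] P
      ∎

  module LeastInFibre {n k : ℕ} (f : Fin n → Fin k) (_≺_ : Fin n → Fin n → Bool)
    (≺-wellFounded : WellFounded (λ i j → T (i ≺ j)))
    (≺-connex : ∀ {i j} → i ≢ j → T (i ≺ j) ⊎ T (j ≺ i)) where

    isLeast : Fin n → Bool
    isLeast i = not (any (λ j → (j ≺ i) ∧ (f j ==F f i)) (allFin n))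

    isLeast⇒¬smaller : ∀ {i j} → T (isLeast i) → T (j ≺ i) → f j ≢ f i
    isLeast⇒¬smaller {i} {j} least j≺i fj≡fi =
      T-not⇒¬T least (any⁺ (λ j → (j ≺ i) ∧ (f j ==F f i)) (tabulate⁺ j j-smaller))
      where
      j-smaller : T ((j ≺ i) ∧ (f j ==F f i))
      j-smaller = Equivalence.from T-∧ (j≺i , ≡⇒==F fj≡fi)

    ¬isLeast⇒smaller : ∀ {i} → ¬ T (isLeast i) → ∃ λ j → T (j ≺ i) × f j ≡ f i
    ¬isLeast⇒smaller ¬least =
      let j , t = satisfied (any⁻ _ (allFin n) (¬T-not⇒T ¬least))
          j≺i , fj==fi = Equivalence.to T-∧ t
      in j , j≺i , ==F⇒≡ fj==fi

    least-exists : ∀ i → ∃ λ l → T (isLeast l) × f l ≡ f i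
    least-exists i = descend i (≺-wellFounded i)
      where
      descend : ∀ i → Acc (λ i j → T (i ≺ j)) i → ∃ λ l → T (isLeast l) × f l ≡ f i
      descend i (acc smaller) with T? (isLeast i)
      ... | yes least = i , least , refl
      ... | no ¬least =
        let j , j≺i , fj≡fi = ¬isLeast⇒smaller ¬least
            l , least , fl≡fj = descend j (smaller j≺i)
        in l , least , trans fl≡fj fj≡fi

    least-unique : ∀ {i j} → T (isLeast i) → T (isLeast j) → f i ≡ f j → i ≡ j
    least-unique {i} {j} least-i least-j fi≡fj with i ≟ j
    ... | yes i≡j = i≡j
    ... | no  i≢j with ≺-connex i≢j
    ...   | inj₁ i≺j = ⊥-elim (isLeast⇒¬smaller least-j i≺j fi≡fj)
    ...   | inj₂ j≺i = ⊥-elim (isLeast⇒¬smaller least-i j≺i (sym fi≡fj))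

    #-least-in-fibre : ∀ {b} → (∃ λ i → f i ≡ b) →
                       #[ n ] (λ j → isLeast j ∧ (f j ==F b)) ≡ 1
    #-least-in-fibre {b} (i , fi≡b) with least-exists i
    ... | l , least-l , fl≡fi =
      #-singleton _ (Equivalence.from T-∧ (least-l , ≡⇒==F fl≡b)) only-l
      where
      fl≡b : f l ≡ b
      fl≡b = trans fl≡fi fi≡b

      only-l : ∀ {j} → T (isLeast j ∧ (f j ==F b)) → j ≡ l
      only-l t = let least-j , fj==b = Equivalence.to T-∧ t
                 in least-unique least-j least-l (trans (==F⇒≡ fj==b) (sym fl≡b))

    #-least-by-fibre : (∀ b → ∃ λ i → f i ≡ b) →
                       ∀ P → #[ n ] (λ j → isLeast j ∧ P (f j)) ≡ #[ k ] P
    #-least-by-fibre surjective = #-by-fibre f isLeast (#-least-in-fibre ∘ surjective)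

  m+n≡o⇒+m≡+o-+n : ∀ {a b c} → a + b ≡ c → ℤ.+ a ≡ ℤ.+ c ℤ.- ℤ.+ b
  m+n≡o⇒+m≡+o-+n {a} {b} refl = sym (begin
    ℤ.+ (a + b) ℤ.- ℤ.+ b ≡⟨ m-n≡m⊖n (a + b) b ⟩
    (a + b) ℤ.⊖ b         ≡⟨ ⊖-≥ (m≤n+m b a) ⟩
    ℤ.+ (a + b ∸ b)       ≡⟨ cong ℤ.+_ (m+n∸n≡m a b) ⟩
    ℤ.+ a                 ∎)

  module _ {n k : ℕ} (π : OrderedPartition n k) where

    -- isOpener π and isCloser π are, definitionally, isLeast for _<F_ and for flip _<F_.
    private
      module Openers = LeastInFibre (w π) _<F_
        (Subrelation.wellFounded (λ {i j} → <F⇒< {a = i} {j}) <-wellFounded) <F-connex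
      module Closers = LeastInFibre (w π) (flip _<F_)
        (Subrelation.wellFounded (λ {i j} → <F⇒< {a = j} {i}) >-wellFounded) (swap ∘ <F-connex)

    #-openers : ∀ P → #[ n ] (λ j → isOpener π j ∧ P (w π j)) ≡ #[ k ] P
    #-openers = Openers.#-least-by-fibre (surj π)

    #-closers : ∀ P → #[ n ] (λ j → isCloser π j ∧ P (w π j)) ≡ #[ k ] P
    #-closers = Closers.#-least-by-fibre (surj π)

    blocks-<F⇒≢ : ∀ {i j} → T (w π i <F w π j) → i ≢ j
    blocks-<F⇒≢ {i} t refl = <F-irrefl {a = w π i} t

    ros-i+rob-i : ∀ i → ros-i π i + rob-i π i ≡ #[ k ] (w π i <F_)
    ros-i+rob-i i =
      trans (#-split-at (isOpener π) (λ j → w π i <F w π j) i (≢-sym ∘ blocks-<F⇒≢))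
            (#-openers (w π i <F_))

    lcs-i+lcb-i : ∀ i → lcs-i π i + lcb-i π i ≡ #[ k ] (_<F w π i)
    lcs-i+lcb-i i =
      trans (#-split-at (isCloser π) (λ j → w π j <F w π i) i blocks-<F⇒≢)
            (#-closers (_<F w π i))

    los-i+lob-i : ∀ i → los-i π i + lob-i π i ≡ #[ k ] (_<F w π i)
    los-i+lob-i i =
      trans (#-split-at (isOpener π) (λ j → w π j <F w π i) i blocks-<F⇒≢)
            (#-openers (_<F w π i))

    rcs-i+rcb-i : ∀ i → rcs-i π i + rcb-i π i ≡ #[ k ] (w π i <F_)
    rcs-i+rcb-i i =
      trans (#-split-at (isCloser π) (λ j → w π i <F w π j) i (≢-sym ∘ blocks-<F⇒≢))
            (#-closers (w π i <F_))

    Σ-below+Σ-above : (f₁ f₂ g₁ g₂ : Fin n → ℕ) →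
                      (∀ i → f₁ i + f₂ i ≡ #[ k ] (_<F w π i)) →
                      (∀ i → g₁ i + g₂ i ≡ #[ k ] (w π i <F_)) →
                      (Σ[ n ] f₁ + Σ[ n ] f₂) + (Σ[ n ] g₁ + Σ[ n ] g₂) ≡ n * (k ∸ 1)
    Σ-below+Σ-above f₁ f₂ g₁ g₂ below above = begin
      (Σ[ n ] f₁ + Σ[ n ] f₂) + (Σ[ n ] g₁ + Σ[ n ] g₂)
        ≡⟨ cong₂ _+_ (Σ-+ n f₁ f₂) (Σ-+ n g₁ g₂) ⟨
      Σ[ n ] (λ i → f₁ i + f₂ i) + Σ[ n ] (λ i → g₁ i + g₂ i)
        ≡⟨ Σ-+ n _ _ ⟨
      Σ[ n ] (λ i → (f₁ i + f₂ i) + (g₁ i + g₂ i))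
        ≡⟨ Σ-constant n (λ i → trans (cong₂ _+_ (below i) (above i)) (#-below+#-above (w π i))) ⟩
      n * (k ∸ 1)
        ∎

    mak+[lcb+rob]≡n[k∸1] : mak π + (lcb π + rob π) ≡ n * (k ∸ 1)
    mak+[lcb+rob]≡n[k∸1] =
      trans (+-shuffle (ros π) (lcs π) (lcb π) (rob π))
            (Σ-below+Σ-above (lcs-i π) (lcb-i π) (ros-i π) (rob-i π) lcs-i+lcb-i ros-i+rob-i)
      where
      +-shuffle : ∀ a b c d → (a + b) + (c + d) ≡ (b + c) + (a + d)
      +-shuffle = solve-∀

    mak′+[los+rcs]≡n[k∸1] : mak′ π + (los π + rcs π) ≡ n * (k ∸ 1)
    mak′+[los+rcs]≡n[k∸1] =
      trans (+-shuffle (lob π) (rcb π) (los π) (rcs π))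
            (Σ-below+Σ-above (los-i π) (lob-i π) (rcs-i π) (rcb-i π) los-i+lob-i rcs-i+rcb-i)
      where
      +-shuffle : ∀ a b c d → (a + b) + (c + d) ≡ (c + a) + (d + b)
      +-shuffle = solve-∀

    mak≡lmak′ : ℤ.+ mak π ≡ lmak′ π
    mak≡lmak′ = m+n≡o⇒+m≡+o-+n mak+[lcb+rob]≡n[k∸1]

    mak′≡lmak : ℤ.+ mak′ π ≡ lmak π
    mak′≡lmak = m+n≡o⇒+m≡+o-+n mak′+[los+rcs]≡n[k∸1]

open Counting using (mak≡lmak′; mak′≡lmak)
open import Data.Nat using (ℕ; _≥_)
open import Data.Integer using (+_; _+_)
open import Data.Product using (_×_; _,_)
open import Relation.Binary.PropositionalEquality using (_≡_; cong)

-- The identities hold for all n and k.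
proposition2 : (n k : ℕ) → n ≥ 1 → k ≥ 1 → (π : OrderedPartition n k) →
    ((+ mak π) + (+ bmaj π) ≡ lmak′ π + (+ bmaj π))
    × ((+ mak′ π) + (+ bmaj π) ≡ lmak π + (+ bmaj π))
    × ((+ mak π) + (+ binv π) ≡ lmak′ π + (+ binv π))
    × ((+ mak′ π) + (+ binv π) ≡ lmak π + (+ binv π))
proposition2 n k _ _ π =
    cong (_+ + bmaj π) (mak≡lmak′ π) , cong (_+ + bmaj π) (mak′≡lmak π)
  , cong (_+ + binv π) (mak≡lmak′ π) , cong (_+ + binv π) (mak′≡lmak π)
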